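{- Let $k\geq 2$ be an integer, let $G$ be a graph and $S\subseteq V(G)$ such that there is no tangle of $(G,S)$ of order $k$. Then for every $R\subseteq V(G)$ with $|R|\leq 7k-8$ there is a tree decomposition $\mathcal D$ of $(G,S)$ of width at most $10k-12$ such that some bag of $\mathcal D$ contains $R$.
   Context: A separation of $G$ is a pair $(A,B)$ of subgraphs of $G$ with $A\cup B=G$ and $E(A\cap B)=\emptyset$; its order is $|V(A)\cap V(B)|$. A tangle of order $k$ in $G$ is a family $\mathcal T$ of separations of $G$ of order less than $k$ such that: (T1) for every separation $(A,B)$ of order at most $k-1$, $(A,B)\in\mathcal T$ or $(B,A)\in\mathcal T$; (T2) for all $(A_1,B_1),(A_2,B_2),(A_3,B_3)\in\mathcal T$, $A_1\cup A_2\cup A_3\neq G$; (T3) for every $(A,B)\in\mathcal T$, $V(A)\ne V(G)$. It is a tangle of $(G,S)$ if moreover (T4) for every $(A,B)\in\mathcal T$, $S\not\subseteq V(A)$. A tree decomposition of a graph $H$ is a pair $(T,(W_x\mid x\in V(T)))$ with $T$ a non-null tree and bags $W_x\subseteq V(H)$ such that each edge of $H$ lies in some bag and for each vertex $v$ the set $\{x: v\in W_x\}$ induces a non-empty subtree; its width is $\max_x|W_x|-1$. A tree decomposition of $(G,S)$ is a tree decomposition of some induced subgraph $H$ of $G$ with $S\subseteq V(H)$ such that for every component $C$ of $G-V(H)$ some bag contains all neighbours of $V(C)$ in $G$. -}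

module Defs where

open import Data.Nat using (ℕ; zero; suc; _+_; _*_; _∸_; _≤_; _<_)
open import Data.Fin using (Fin; toℕ)
open import Data.Fin.Subset using (Subset; _∈_; _∉_; _⊆_; _∩_; ∣_∣)
open import Data.Bool using (Bool; true; false)
open import Data.Product using (Σ; ∃; _×_; _,_)
open import Data.Sum using (_⊎_)
open import Relation.Nullary using (¬_)
open import Relation.Binary.PropositionalEquality using (_≡_)

record Graph (n : ℕ) : Set where
  field
    adj     : Fin n → Fin n → Bool
    adj-sym : ∀ u v → adj u v ≡ true → adj v u ≡ true
    adj-irr : ∀ u → adj u u ≡ false
open Graph public

data Walk {n : ℕ} (G : Graph n) (X : Fin n → Set) : Fin n → Fin n → Set where
  stay : ∀ {u} → X u → Walk G X u u
  step : ∀ {u w v} → X u → adj G u w ≡ true → Walk G X w v → Walk G X u v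

-- The subgraph of G induced on X is connected (X may be empty here).
ConnectedOn : {n : ℕ} → Graph n → (Fin n → Set) → Set
ConnectedOn G X = ∀ u v → X u → X v → Walk G X u v

Cycle : {m : ℕ} → Graph m → Set
Cycle {m} T =
  Σ ℕ λ l → 3 ≤ l × Σ (Fin l → Fin m) λ f →
    (∀ i j → f i ≡ f j → i ≡ j) ×
    (∀ (i j : Fin l) →
       (toℕ j ≡ suc (toℕ i) ⊎ (suc (toℕ i) ≡ l × toℕ j ≡ 0)) →
       adj T (f i) (f j) ≡ true)

record IsTree {m : ℕ} (T : Graph (suc m)) : Set where
  field
    connected : ∀ u v → Walk T (λ _ → Fin (suc m)) u v
    acyclic   : ¬ Cycle T

record Subgraph {n : ℕ} (G : Graph n) : Set where
  field
    V       : Subset n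
    E       : Fin n → Fin n → Bool
    E-sym   : ∀ u v → E u v ≡ true → E v u ≡ true
    E-sub   : ∀ u v → E u v ≡ true → adj G u v ≡ true
    E-ends  : ∀ u v → E u v ≡ true → u ∈ V × v ∈ V
open Subgraph public

record Separation {n : ℕ} (G : Graph n) : Set where
  constructor sep
  field
    A B      : Subgraph G
    coverV   : ∀ v → v ∈ V A ⊎ v ∈ V B
    coverE   : ∀ u v → adj G u v ≡ true → E A u v ≡ true ⊎ E B u v ≡ true
    disjE    : ∀ u v → ¬ (E A u v ≡ true × E B u v ≡ true)
open Separation public

order : {n : ℕ} {G : Graph n} → Separation G → ℕ
order s = ∣ V (A s) ∩ V (B s) ∣

swap : {n : ℕ} {G : Graph n} → Separation G → Separation G
swap (sep A B cV cE dE) =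
  sep B A (λ v → Data.Sum.swap (cV v))
          (λ u v e → Data.Sum.swap (cE u v e))
          (λ u v p → dE u v (Data.Product.swap p))
  where import Data.Sum ; import Data.Product

Covers3 : {n : ℕ} {G : Graph n} → Subgraph G → Subgraph G → Subgraph G → Set
Covers3 {G = G} A₁ A₂ A₃ =
  (∀ v → v ∈ V A₁ ⊎ v ∈ V A₂ ⊎ v ∈ V A₃) ×
  (∀ u v → adj G u v ≡ true → E A₁ u v ≡ true ⊎ E A₂ u v ≡ true ⊎ E A₃ u v ≡ true)

record TangleOf {n : ℕ} (G : Graph n) (S : Subset n) (k : ℕ) : Set₁ where
  field
    𝒯     : Separation G → Set
    ord   : ∀ s → 𝒯 s → order s < k
    T1    : ∀ s → order s ≤ k ∸ 1 → 𝒯 s ⊎ 𝒯 (swap s)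
    T2    : ∀ s₁ s₂ s₃ → 𝒯 s₁ → 𝒯 s₂ → 𝒯 s₃ → ¬ Covers3 (A s₁) (A s₂) (A s₃)
    T3    : ∀ s → 𝒯 s → ¬ (∀ v → v ∈ V (A s))
    T4    : ∀ s → 𝒯 s → ¬ (S ⊆ V (A s))

-- C is (the vertex set of) a component of G - U.
IsComponentOutside : {n : ℕ} → Graph n → Subset n → Subset n → Set
IsComponentOutside G U C =
  (∃ λ c → c ∈ C) ×
  (∀ v → v ∈ C → v ∉ U) ×
  ConnectedOn G (λ v → v ∈ C) ×
  (∀ c d → c ∈ C → d ∉ U → adj G c d ≡ true → d ∈ C)

record TreeDecOf {n : ℕ} (G : Graph n) (S : Subset n) : Set where
  field
    U        : Subset n                 -- V(H), H = G[U]
    S⊆U      : S ⊆ U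
    m        : ℕ
    T        : Graph (suc m)
    tree     : IsTree T
    W        : Fin (suc m) → Subset n
    W⊆U      : ∀ x → W x ⊆ U
    edgeBag  : ∀ u v → u ∈ U → v ∈ U → adj G u v ≡ true →
               ∃ λ x → u ∈ W x × v ∈ W x
    vNonEmp  : ∀ v → v ∈ U → ∃ λ x → v ∈ W x
    vConn    : ∀ v → v ∈ U → ConnectedOn T (λ x → v ∈ W x)
    compBag  : ∀ C → IsComponentOutside G U C →
               ∃ λ x → ∀ v → v ∉ C → (∃ λ c → c ∈ C × adj G c v ≡ true) → v ∈ W x
open TreeDecOf public

WidthAtMost : {n : ℕ} {G : Graph n} {S : Subset n} → TreeDecOf G S → ℕ → Set
WidthAtMost D w = ∀ x → ∣ W D x ∣ ∸ 1 ≤ w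

{-# OPTIONS --safe #-}
-- Write w = k - 1 and ρ = 7k - 8.  By induction on a vertex set Z we build a tree decomposition
-- of the part of (G, S) inside Z whose root bag contains a given R ⊆ Z with |R| ≤ ρ, assuming
-- that R contains every vertex of Z with a neighbour outside Z.  First R is enlarged by vertices
-- of S ∩ Z; if all of S ∩ Z fits, a single bag suffices.  Otherwise |R| = ρ.  The separations
-- of order ≤ w whose first side holds less than a third of R satisfy (T2) and (T3) by counting
-- but are not a tangle, so (T1) or (T4) fails: some separation (P, Q) of order ≤ w leaves at
-- least a third of R on both sides, or less than a third of R on a side P ⊇ S.  Since
-- 6w ≤ ρ, a side P′ we recurse on has |R ∩ P′| + w ≤ ρ, so its root set (R ∩ P′) ∪ (Z ∩ P ∩ Q)
-- has at most ρ vertices while Z ∩ P′ misses a vertex of R.  When S ⊆ P, the side Q is covered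
-- by the single bag Z ∩ Q ∩ (R ∪ P), which contains S ∩ Z ∩ Q.  Both parts hang below the new
-- root bag R ∪ (Z ∩ P ∩ Q), so bags have at most ρ + w = 8k - 9 vertices: the width is at most
-- 8k - 10 ≤ 10k - 12.
module Submission where

open import Defs
open import Data.Bool using (Bool; true; false; not; _∨_)
open import Data.Bool.Properties using (∨-comm) renaming (_≟_ to _≟ᵇ_)
open import Data.Empty using (⊥; ⊥-elim)
open import Data.Fin as Fin
  using (Fin; zero; suc; toℕ; fromℕ; fromℕ<; inject₁; _↑ˡ_; _↑ʳ_; splitAt; join)
open import Data.Fin.Induction using (<-wellFounded)
open import Data.Fin.Properties
  using (any?; all?; toℕ-fromℕ; toℕ-fromℕ<; toℕ-inject₁; toℕ<n; toℕ-↑ˡ; toℕ-↑ʳ; splitAt-↑ˡ; splitAt-↑ʳ; join-splitAt)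
  renaming (_≟_ to _≟ᶠ_)
open import Data.Fin.Subset hiding (⊥)
open import Data.Fin.Subset.Induction using (⊂-wellFounded; ⊃-wellFounded)
open import Data.Fin.Subset.Properties
open import Data.List using ([]; _∷_; allFin)
open import Data.List.Extrema.Nat using (argmax; f[xs]≤f[argmax])
open import Data.List.Membership.Propositional.Properties using (∈-allFin)
import Data.List.Relation.Unary.All as All
open import Data.Nat using (ℕ; zero; suc; _+_; _*_; _∸_; _≤_; _<_; z≤n; s≤s)
open import Data.Nat.Properties
open import Data.Nat.Tactic.RingSolver using (solve)
open import Data.Product using (Σ; ∃; ∃₂; _×_; _,_; proj₁; proj₂; uncurry)
open import Data.Sum using (_⊎_; inj₁; inj₂; [_,_]′)
import Data.Sum as Sum
open import Data.Vec as Vec using ()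
open import Function using (id; _∘_)
open import Induction.WellFounded using (Acc; acc)
open import Relation.Nullary using (¬_; Dec; yes; no)
open import Relation.Nullary.Decidable using (⌊_⌋; map′; _×-dec_; _⊎-dec_; _→-dec_; ¬?)
open import Relation.Binary.PropositionalEquality

private variable n : ℕ

∣p∪q∣+∣p∩q∣≡∣p∣+∣q∣ : ∀ (p q : Subset n) → ∣ p ∪ q ∣ + ∣ p ∩ q ∣ ≡ ∣ p ∣ + ∣ q ∣
∣p∪q∣+∣p∩q∣≡∣p∣+∣q∣ Vec.[]                Vec.[]                = refl
∣p∪q∣+∣p∩q∣≡∣p∣+∣q∣ (outside Vec.∷ p) (outside Vec.∷ q) = ∣p∪q∣+∣p∩q∣≡∣p∣+∣q∣ p q
∣p∪q∣+∣p∩q∣≡∣p∣+∣q∣ (inside  Vec.∷ p) (outside Vec.∷ q) = cong suc (∣p∪q∣+∣p∩q∣≡∣p∣+∣q∣ p q)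
∣p∪q∣+∣p∩q∣≡∣p∣+∣q∣ (outside Vec.∷ p) (inside  Vec.∷ q) =
  trans (cong suc (∣p∪q∣+∣p∩q∣≡∣p∣+∣q∣ p q)) (sym (+-suc ∣ p ∣ ∣ q ∣))
∣p∪q∣+∣p∩q∣≡∣p∣+∣q∣ (inside  Vec.∷ p) (inside  Vec.∷ q) =
  cong suc (trans (+-suc ∣ p ∪ q ∣ ∣ p ∩ q ∣)
                  (trans (cong suc (∣p∪q∣+∣p∩q∣≡∣p∣+∣q∣ p q)) (sym (+-suc ∣ p ∣ ∣ q ∣))))

∣p∪q∣≤∣p∣+∣q∣ : ∀ (p q : Subset n) → ∣ p ∪ q ∣ ≤ ∣ p ∣ + ∣ q ∣
∣p∪q∣≤∣p∣+∣q∣ p q = ≤-trans (m≤m+n ∣ p ∪ q ∣ ∣ p ∩ q ∣) (≤-reflexive (∣p∪q∣+∣p∩q∣≡∣p∣+∣q∣ p q))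

∣r∩p∣+∣r∩q∣≤∣r∣+∣p∩q∣ : ∀ (r p q : Subset n) → ∣ r ∩ p ∣ + ∣ r ∩ q ∣ ≤ ∣ r ∣ + ∣ p ∩ q ∣
∣r∩p∣+∣r∩q∣≤∣r∣+∣p∩q∣ r p q = begin
  ∣ r ∩ p ∣ + ∣ r ∩ q ∣                               ≡⟨ ∣p∪q∣+∣p∩q∣≡∣p∣+∣q∣ (r ∩ p) (r ∩ q) ⟨
  ∣ (r ∩ p) ∪ (r ∩ q) ∣ + ∣ (r ∩ p) ∩ (r ∩ q) ∣     ≤⟨ +-mono-≤ (p⊆q⇒∣p∣≤∣q∣ ∪⊆r) (p⊆q⇒∣p∣≤∣q∣ ∩⊆p∩q) ⟩
  ∣ r ∣ + ∣ p ∩ q ∣                                   ∎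
  where
  open ≤-Reasoning
  ∪⊆r : (r ∩ p) ∪ (r ∩ q) ⊆ r
  ∪⊆r x∈ with x∈p∪q⁻ (r ∩ p) (r ∩ q) x∈
  ... | inj₁ x∈r∩p = p∩q⊆p r p x∈r∩p
  ... | inj₂ x∈r∩q = p∩q⊆p r q x∈r∩q
  ∩⊆p∩q : (r ∩ p) ∩ (r ∩ q) ⊆ p ∩ q
  ∩⊆p∩q x∈ = x∈p∩q⁺ (p∩q⊆q r p (p∩q⊆p _ _ x∈) , p∩q⊆q r q (p∩q⊆q _ _ x∈))

p⊈q⇒∃∉ : ∀ {p q : Subset n} → p ⊈ q → ∃ λ x → x ∈ p × x ∉ q
p⊈q⇒∃∉ {p = p} {q} p⊈q with any? (λ x → (x ∈? p) ×-dec ¬? (x ∈? q))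
... | yes witness = witness
... | no  none    = ⊥-elim (p⊈q p⊆q)
  where
  p⊆q : p ⊆ q
  p⊆q {x} x∈p with x ∈? q
  ... | yes x∈q = x∈q
  ... | no  x∉q = ⊥-elim (none (x , x∈p , x∉q))

z∩p∩[r∪q]⊆z∩p : ∀ (z p r q : Subset n) → z ∩ p ∩ (r ∪ q) ⊆ z ∩ p
z∩p∩[r∪q]⊆z∩p z p r q x∈ =
  let x∈z , x∈p∩[r∪q] = x∈p∩q⁻ z _ x∈ in x∈p∩q⁺ (x∈z , p∩q⊆p p (r ∪ q) x∈p∩[r∪q])

∣z∩p∩[r∪q]∣≤∣r∩p∣+∣p∩q∣ : ∀ (z p r q : Subset n) → ∣ z ∩ p ∩ (r ∪ q) ∣ ≤ ∣ r ∩ p ∣ + ∣ p ∩ q ∣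
∣z∩p∩[r∪q]∣≤∣r∩p∣+∣p∩q∣ z p r q = ≤-trans (p⊆q⇒∣p∣≤∣q∣ ⊆r∩p∪p∩q) (∣p∪q∣≤∣p∣+∣q∣ (r ∩ p) (p ∩ q))
  where
  ⊆r∩p∪p∩q : z ∩ p ∩ (r ∪ q) ⊆ r ∩ p ∪ p ∩ q
  ⊆r∩p∪p∩q x∈ with x∈p∩q⁻ p _ (p∩q⊆q z _ x∈)
  ... | x∈p , x∈r∪q with x∈p∪q⁻ r q x∈r∪q
  ...   | inj₁ x∈r = x∈p∪q⁺ (inj₁ (x∈p∩q⁺ (x∈r , x∈p)))
  ...   | inj₂ x∈q = x∈p∪q⁺ (inj₂ (x∈p∩q⁺ (x∈p , x∈q)))

z∩p⊂z : ∀ {r z p : Subset n} → r ⊆ z → ∣ r ∩ p ∣ < ∣ r ∣ → z ∩ p ⊂ z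
z∩p⊂z {r = r} {z} {p} r⊆z ∣r∩p∣<∣r∣ with r ⊆? p
... | yes r⊆p = ⊥-elim (<⇒≱ ∣r∩p∣<∣r∣ (p⊆q⇒∣p∣≤∣q∣ (λ x∈r → x∈p∩q⁺ (x∈r , r⊆p x∈r))))
... | no  r⊈p = let x , x∈r , x∉p = p⊈q⇒∃∉ r⊈p in
  p∩q⊆p z p , x , r⊆z x∈r , λ x∈z∩p → x∉p (p∩q⊆q z p x∈z∩p)

r⊂r∪⁅x⁆ : ∀ {r : Subset n} {x} → x ∉ r → r ⊂ r ∪ ⁅ x ⁆
r⊂r∪⁅x⁆ {x = x} x∉r = p⊆p∪q ⁅ x ⁆ , x , x∈p∪q⁺ (inj₂ (x∈⁅x⁆ x)) , x∉r

r∪⁅x⁆⊆t : ∀ {r t : Subset n} {x} → r ⊆ t → x ∈ t → r ∪ ⁅ x ⁆ ⊆ t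
r∪⁅x⁆⊆t {r = r} {t} {x} r⊆t x∈t y∈ with x∈p∪q⁻ r ⁅ x ⁆ y∈
... | inj₁ y∈r = r⊆t y∈r
... | inj₂ y∈x = subst (_∈ t) (sym (x∈⁅y⁆⇒x≡y x y∈x)) x∈t

∣p∪⁅x⁆∣≤1+∣p∣ : ∀ (p : Subset n) x → ∣ p ∪ ⁅ x ⁆ ∣ ≤ suc ∣ p ∣
∣p∪⁅x⁆∣≤1+∣p∣ p x = begin
  ∣ p ∪ ⁅ x ⁆ ∣     ≤⟨ ∣p∪q∣≤∣p∣+∣q∣ p ⁅ x ⁆ ⟩
  ∣ p ∣ + ∣ ⁅ x ⁆ ∣ ≡⟨ cong (∣ p ∣ +_) (∣⁅x⁆∣≡1 x) ⟩
  ∣ p ∣ + 1         ≡⟨ +-comm ∣ p ∣ 1 ⟩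
  suc ∣ p ∣         ∎
  where open ≤-Reasoning

extend-within : ∀ m {r t : Subset n} → r ⊆ t → ∣ r ∣ ≤ m →
                ∃ λ r′ → r ⊆ r′ × r′ ⊆ t × ∣ r′ ∣ ≤ m × (∣ r′ ∣ ≡ m ⊎ t ⊆ r′)
extend-within m = go (⊃-wellFounded _)
  where
  go : ∀ {r t} → Acc _⊃_ r → r ⊆ t → ∣ r ∣ ≤ m →
       ∃ λ r′ → r ⊆ r′ × r′ ⊆ t × ∣ r′ ∣ ≤ m × (∣ r′ ∣ ≡ m ⊎ t ⊆ r′)
  go {r} {t} (acc rec) r⊆t ∣r∣≤m with t ⊆? r | ∣ r ∣ <? m
  ... | yes t⊆r | _        = r , id , r⊆t , ∣r∣≤m , inj₂ t⊆r
  ... | no  _   | no ∣r∣≮m = r , id , r⊆t , ∣r∣≤m , inj₁ (≤-antisym ∣r∣≤m (≮⇒≥ ∣r∣≮m))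
  ... | no  t⊈r | yes ∣r∣<m =
    let x , x∈t , x∉r              = p⊈q⇒∃∉ t⊈r
        r′ , r∪x⊆r′ , r′⊆t , done = go (rec (r⊂r∪⁅x⁆ x∉r)) (r∪⁅x⁆⊆t r⊆t x∈t)
                                       (≤-trans (∣p∪⁅x⁆∣≤1+∣p∣ r x) ∣r∣<m)
    in r′ , r∪x⊆r′ ∘ p⊆p∪q ⁅ x ⁆ , r′⊆t , done

module _ {n : ℕ} {G : Graph n} {X : Fin n → Set} where

  walk-head : ∀ {u v} → Walk G X u v → X u
  walk-head (stay x)     = x
  walk-head (step x _ _) = x

  _++ʷ_ : ∀ {u v w} → Walk G X u v → Walk G X v w → Walk G X u w
  stay _     ++ʷ q = q
  step x e p ++ʷ q = step x e (p ++ʷ q)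

  reverseʷ : ∀ {u v} → Walk G X u v → Walk G X v u
  reverseʷ (stay x)               = stay x
  reverseʷ (step {u} {w} x e p) = reverseʷ p ++ʷ step (walk-head p) (adj-sym G u w e) (stay x)

  walk-preserves : (I : Fin n → Set) → (∀ {u v} → X u → X v → adj G u v ≡ true → I u → I v) →
                   ∀ {u v} → Walk G X u v → I u → I v
  walk-preserves I step-I (stay _)     Iu = Iu
  walk-preserves I step-I (step x e p) Iu = walk-preserves I step-I p (step-I x (walk-head p) e Iu)

maximum-at : ∀ {l} (g : Fin (suc l) → ℕ) → Σ (Fin (suc l)) λ i → ∀ j → g j ≤ g i
maximum-at g = argmax g zero (allFin _) , λ j → All.lookup (f[xs]≤f[argmax] {f = g} zero (allFin _)) (∈-allFin j)

Follows : ℕ → ℕ → ℕ → Set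
Follows l a b = b ≡ suc a ⊎ (suc a ≡ l × b ≡ 0)

successor : ∀ {l} (i : Fin l) → Σ (Fin l) λ j → Follows l (toℕ i) (toℕ j)
successor {suc l} i with suc (toℕ i) <? suc l
... | yes lt  = fromℕ< lt , inj₁ (toℕ-fromℕ< lt)
... | no  ¬lt = zero , inj₂ (≤-antisym (toℕ<n i) (≮⇒≥ ¬lt) , refl)

predecessor : ∀ {l} (i : Fin l) → Σ (Fin l) λ h → Follows l (toℕ h) (toℕ i)
predecessor {suc l} zero    = fromℕ l , inj₂ (cong suc (toℕ-fromℕ l) , refl)
predecessor {suc l} (suc i) = inject₁ i , inj₁ (cong suc (sym (toℕ-inject₁ i)))

no-mutual-follow : ∀ {l a b} → 3 ≤ l → Follows l a b → Follows l b a → ⊥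
no-mutual-follow _              (inj₁ refl)          (inj₁ ())
no-mutual-follow (s≤s (s≤s ())) (inj₁ refl)          (inj₂ (refl , refl))
no-mutual-follow (s≤s (s≤s ())) (inj₂ (refl , refl)) (inj₁ refl)

-- Node 0 is the root; the parent of the root is irrelevant.
record RootedTree (m : ℕ) : Set where
  field
    parent   : Fin (suc m) → Fin (suc m)
    parent-< : ∀ x → x ≢ zero → parent x Fin.< x
open RootedTree public

module _ {m : ℕ} (T : RootedTree m) where

  childOf : Fin (suc m) → Fin (suc m) → Bool
  childOf zero    _ = false
  childOf (suc x) y = ⌊ parent T (suc x) ≟ᶠ y ⌋

  childOf⇒parent : ∀ x y → childOf x y ≡ true → x ≢ zero × parent T x ≡ y
  childOf⇒parent (suc x) y h with parent T (suc x) ≟ᶠ y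
  ... | yes p = (λ ()) , p

  parent⇒childOf : ∀ x → x ≢ zero → childOf x (parent T x) ≡ true
  parent⇒childOf zero    x≢0 = ⊥-elim (x≢0 refl)
  parent⇒childOf (suc x) _ with parent T (suc x) ≟ᶠ parent T (suc x)
  ... | yes _  = refl
  ... | no ¬eq = ⊥-elim (¬eq refl)

  childOf-irrefl : ∀ x → childOf x x ≡ false
  childOf-irrefl x with childOf x x in eq
  ... | false = refl
  ... | true  with childOf⇒parent x x eq
  ...   | x≢0 , px≡x = ⊥-elim (<-irrefl (cong toℕ px≡x) (parent-< T x x≢0))

  treeGraph : Graph (suc m)
  treeGraph = record
    { adj     = λ x y → childOf x y ∨ childOf y x
    ; adj-sym = λ x y e → trans (∨-comm (childOf y x) (childOf x y)) e
    ; adj-irr = λ x → cong₂ _∨_ (childOf-irrefl x) (childOf-irrefl x)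
    }

  parent-adjacent : ∀ x → x ≢ zero → adj treeGraph x (parent T x) ≡ true
  parent-adjacent x x≢0 = cong (_∨ childOf (parent T x) x) (parent⇒childOf x x≢0)

  smaller-neighbour-is-parent : ∀ x y → adj treeGraph x y ≡ true → toℕ y ≤ toℕ x → parent T x ≡ y
  smaller-neighbour-is-parent x y e y≤x with childOf x y in xy | childOf y x in yx
  ... | true  | _     = proj₂ (childOf⇒parent x y xy)
  ... | false | true  with childOf⇒parent y x yx
  ...   | y≢0 , refl = ⊥-elim (<-irrefl refl (<-≤-trans (parent-< T y y≢0) y≤x))
  smaller-neighbour-is-parent x y () y≤x | false | false

  -- Y is the node set of a subtree with highest node t.
  HangsFrom : Fin (suc m) → (Fin (suc m) → Set) → Set
  HangsFrom t Y = ∀ x → Y x → x ≢ t → x ≢ zero × Y (parent T x)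

  climb : ∀ {t Y} → HangsFrom t Y → ∀ x → Y x → Walk treeGraph Y x t
  climb {t} {Y} hangs x Yx = go x Yx (<-wellFounded x)
    where
    go : ∀ x → Y x → Acc Fin._<_ x → Walk treeGraph Y x t
    go x Yx (acc rs) with x ≟ᶠ t
    ... | yes refl = stay Yx
    ... | no x≢t with hangs x Yx x≢t
    ...   | x≢0 , Ypx = step Yx (parent-adjacent x x≢0) (go (parent T x) Ypx (rs (parent-< T x x≢0)))

  hangs-from-root : ∀ {t} Y → HangsFrom t Y → Y zero → HangsFrom zero Y
  hangs-from-root {t} Y hangs Y0 with zero ≟ᶠ t
  ... | yes refl = hangs
  ... | no  0≢t  = ⊥-elim (proj₁ (hangs zero Y0 0≢t) refl)

  hangs⇒connected : ∀ {t Y} → HangsFrom t Y → ConnectedOn treeGraph Y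
  hangs⇒connected hangs u v Yu Yv = climb hangs u Yu ++ʷ reverseʷ (climb hangs v Yv)

  -- Both cycle-neighbours of the node of largest index would be its parent.
  treeGraph-acyclic : ¬ Cycle treeGraph
  treeGraph-acyclic (0 , () , _)
  treeGraph-acyclic (suc l , 3≤l , f , f-inj , f-adj) with maximum-at (λ i → toℕ (f i))
  ... | i , max with successor i | predecessor i
  ...   | j , i→j | h , h→i = no-mutual-follow 3≤l i→h h→i
    where
    fj≡fh : f j ≡ f h
    fj≡fh = trans (sym (smaller-neighbour-is-parent (f i) (f j) (f-adj i j i→j) (max j)))
                  (smaller-neighbour-is-parent (f i) (f h) (adj-sym treeGraph (f h) (f i) (f-adj h i h→i)) (max h))
    i→h : Follows (suc l) (toℕ i) (toℕ h)
    i→h = subst (λ k → Follows (suc l) (toℕ i) (toℕ k)) (f-inj j h fj≡fh) i→j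

  treeGraph-isTree : IsTree treeGraph
  treeGraph-isTree = record
    { connected = λ u v → hangs⇒connected {t = zero} (λ x _ x≢0 → x≢0 , parent T x) u v u v
    ; acyclic   = treeGraph-acyclic
    }

module Join (m : Bool → ℕ) (T : (s : Bool) → RootedTree (m s)) where

  left right : ℕ
  left  = suc (m true)
  right = suc (m false)

  ι : (s : Bool) → Fin (suc (m s)) → Fin (suc (left + right))
  ι true  i = suc (i ↑ˡ right)
  ι false j = suc (left ↑ʳ j)

  data View : Fin (suc (left + right)) → Set where
    root  : View zero
    child : ∀ s i → View (ι s i)

  view : ∀ x → View x
  view zero    = root
  view (suc y) = from-split y (splitAt left y) (join-splitAt left right y)
    where
    from-split : ∀ y s → join left right s ≡ y → View (suc y)
    from-split _ (inj₁ i) refl = child true i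
    from-split _ (inj₂ j) refl = child false j

  branch : {B : Set} → B → ((s : Bool) → Fin (suc (m s)) → B) → Fin (suc (left + right)) → B
  branch z f zero    = z
  branch z f (suc y) = [ f true , f false ]′ (splitAt left y)

  branch-ι : ∀ {B} (z : B) f s i → branch z f (ι s i) ≡ f s i
  branch-ι z f true  i = cong [ f true , f false ]′ (splitAt-↑ˡ left i right)
  branch-ι z f false j = cong [ f true , f false ]′ (splitAt-↑ʳ left right j)

  ι-mono-< : ∀ s {i j} → i Fin.< j → ι s i Fin.< ι s j
  ι-mono-< true  {i} {j} i<j = s≤s (subst₂ _<_ (sym (toℕ-↑ˡ i right)) (sym (toℕ-↑ˡ j right)) i<j)
  ι-mono-< false {i} {j} i<j = s≤s (subst₂ _<_ (sym (toℕ-↑ʳ left i)) (sym (toℕ-↑ʳ left j)) (+-monoʳ-< left i<j))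

  zero<ι : ∀ s i → Fin.zero {left + right} Fin.< ι s i
  zero<ι true  _ = s≤s z≤n
  zero<ι false _ = s≤s z≤n

  lifted-parent : (s : Bool) → Fin (suc (m s)) → Fin (suc (left + right))
  lifted-parent s zero    = zero
  lifted-parent s (suc i) = ι s (parent (T s) (suc i))

  joined : RootedTree (left + right)
  joined = record { parent = branch zero lifted-parent ; parent-< = λ x → parent-<′ x (view x) }
    where
    parent-<′ : ∀ x → View x → x ≢ zero → branch zero lifted-parent x Fin.< x
    parent-<′ _ root        0≢0 = ⊥-elim (0≢0 refl)
    parent-<′ _ (child s zero) _ rewrite branch-ι zero lifted-parent s zero = zero<ι s zero
    parent-<′ _ (child s (suc i)) _ rewrite branch-ι zero lifted-parent s (suc i) =
      ι-mono-< s (parent-< (T s) (suc i) (λ ()))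

  parent-ι-zero : ∀ s → parent joined (ι s zero) ≡ zero
  parent-ι-zero s = branch-ι zero lifted-parent s zero

  parent-ι : ∀ s i → i ≢ zero → parent joined (ι s i) ≡ ι s (parent (T s) i)
  parent-ι s zero    i≢0 = ⊥-elim (i≢0 refl)
  parent-ι s (suc i) _   = branch-ι zero lifted-parent s (suc i)

module _ {n : ℕ} (G : Graph n) where

  record VertexSeparation (P Q : Subset n) : Set where
    field
      covers : ∀ v → v ∈ P ⊎ v ∈ Q
      splits : ∀ u v → adj G u v ≡ true → (u ∈ P × v ∈ P) ⊎ (u ∈ Q × v ∈ Q)
  open VertexSeparation public

  vertexSeparation? : ∀ P Q → Dec (VertexSeparation P Q)
  vertexSeparation? P Q =
    map′ (uncurry λ c s → record { covers = c ; splits = s }) (λ PQ → covers PQ , splits PQ)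
         (all? (λ v → (v ∈? P) ⊎-dec (v ∈? Q)) ×-dec
          all? (λ u → all? λ v → (adj G u v ≟ᵇ true) →-dec
                                  (((u ∈? P) ×-dec (v ∈? P)) ⊎-dec ((u ∈? Q) ×-dec (v ∈? Q)))))

  swapᵛ : ∀ {P Q} → VertexSeparation P Q → VertexSeparation Q P
  swapᵛ PQ = record { covers = λ v → Sum.swap (covers PQ v) ; splits = λ u v e → Sum.swap (splits PQ u v e) }

  separation⇒vertexSeparation : (s : Separation G) → VertexSeparation (V (A s)) (V (B s))
  separation⇒vertexSeparation s = record { covers = coverV s ; splits = edge-side }
    where
    edge-side : ∀ u v → adj G u v ≡ true → (u ∈ V (A s) × v ∈ V (A s)) ⊎ (u ∈ V (B s) × v ∈ V (B s))
    edge-side u v e with coverE s u v e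
    ... | inj₁ e∈A = inj₁ (E-ends (A s) u v e∈A)
    ... | inj₂ e∈B = inj₂ (E-ends (B s) u v e∈B)

Balanced : Subset n → Subset n → Subset n → Set
Balanced R P Q = ∣ R ∣ ≤ 3 * ∣ R ∩ P ∣ × ∣ R ∣ ≤ 3 * ∣ R ∩ Q ∣

Small : Subset n → Subset n → Set
Small R P = 3 * ∣ R ∩ P ∣ < ∣ R ∣

no-three-small-parts : ∀ {r a b c} → r ≤ a + (b + c) → 3 * a < r → 3 * b < r → 3 * c < r → ⊥
no-three-small-parts {r} {a} {b} {c} r≤a+b+c 3a<r 3b<r 3c<r = <-irrefl refl (begin-strict
  3 * r                    ≤⟨ *-monoʳ-≤ 3 r≤a+b+c ⟩
  3 * (a + (b + c))        ≡⟨ solve (a ∷ b ∷ c ∷ []) ⟩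
  3 * a + (3 * b + 3 * c)  <⟨ +-mono-< 3a<r (+-mono-< 3b<r 3c<r) ⟩
  r + (r + r)              ≡⟨ solve (r ∷ []) ⟩
  3 * r                    ∎)
  where open ≤-Reasoning

module _ (G : Graph n) (S : Subset n) (k : ℕ) (R : Subset n) where

  GoodSeparation : Subset n → Subset n → Set
  GoodSeparation P Q = VertexSeparation G P Q × ∣ P ∩ Q ∣ ≤ k × (Balanced R P Q ⊎ Small R P × S ⊆ P)

  tangle-of-small-sides : (∀ P Q → ¬ GoodSeparation P Q) → TangleOf G S (suc k)
  tangle-of-small-sides none = record
    { 𝒯 = 𝒯 ; ord = λ _ → proj₁ ; T1 = T1 ; T2 = T2 ; T3 = T3 ; T4 = T4 }
    where
    𝒯 : Separation G → Set
    𝒯 s = order s < suc k × Small R (V (A s))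

    T1 : ∀ s → order s ≤ k → 𝒯 s ⊎ 𝒯 (swap s)
    T1 s o with 3 * ∣ R ∩ V (A s) ∣ <? ∣ R ∣ | 3 * ∣ R ∩ V (B s) ∣ <? ∣ R ∣
    ... | yes A-small | _           = inj₁ (s≤s o , A-small)
    ... | no  _       | yes B-small = inj₂ (s≤s (subst (_≤ k) (cong ∣_∣ (∩-comm (V (A s)) (V (B s)))) o) , B-small)
    ... | no  A-large | no  B-large =
      ⊥-elim (none _ _ (separation⇒vertexSeparation G s , o , inj₁ (≮⇒≥ A-large , ≮⇒≥ B-large)))

    T2 : ∀ s₁ s₂ s₃ → 𝒯 s₁ → 𝒯 s₂ → 𝒯 s₃ → ¬ Covers3 (A s₁) (A s₂) (A s₃)
    T2 s₁ s₂ s₃ (_ , small₁) (_ , small₂) (_ , small₃) (covers₃ , _) =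
      no-three-small-parts {a = ∣ R₁ ∣} {∣ R₂ ∣} {∣ R₃ ∣} ∣R∣≤ small₁ small₂ small₃
      where
      R₁ = R ∩ V (A s₁)
      R₂ = R ∩ V (A s₂)
      R₃ = R ∩ V (A s₃)
      R⊆ : R ⊆ R₁ ∪ (R₂ ∪ R₃)
      R⊆ {v} v∈R with covers₃ v
      ... | inj₁ v∈A₁        = x∈p∪q⁺ (inj₁ (x∈p∩q⁺ (v∈R , v∈A₁)))
      ... | inj₂ (inj₁ v∈A₂) = x∈p∪q⁺ (inj₂ (x∈p∪q⁺ (inj₁ (x∈p∩q⁺ (v∈R , v∈A₂)))))
      ... | inj₂ (inj₂ v∈A₃) = x∈p∪q⁺ (inj₂ (x∈p∪q⁺ (inj₂ (x∈p∩q⁺ (v∈R , v∈A₃)))))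
      ∣R∣≤ : ∣ R ∣ ≤ ∣ R₁ ∣ + (∣ R₂ ∣ + ∣ R₃ ∣)
      ∣R∣≤ = begin
        ∣ R ∣                     ≤⟨ p⊆q⇒∣p∣≤∣q∣ R⊆ ⟩
        ∣ R₁ ∪ (R₂ ∪ R₃) ∣        ≤⟨ ∣p∪q∣≤∣p∣+∣q∣ R₁ (R₂ ∪ R₃) ⟩
        ∣ R₁ ∣ + ∣ R₂ ∪ R₃ ∣      ≤⟨ +-monoʳ-≤ ∣ R₁ ∣ (∣p∪q∣≤∣p∣+∣q∣ R₂ R₃) ⟩
        ∣ R₁ ∣ + (∣ R₂ ∣ + ∣ R₃ ∣) ∎
        where open ≤-Reasoning

    T3 : ∀ s → 𝒯 s → ¬ (∀ v → v ∈ V (A s))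
    T3 s (_ , small) A-all = <-irrefl refl (<-≤-trans small (begin
      ∣ R ∣                 ≤⟨ p⊆q⇒∣p∣≤∣q∣ {p = R} (λ {v} v∈R → x∈p∩q⁺ (v∈R , A-all v)) ⟩
      ∣ R ∩ V (A s) ∣       ≤⟨ m≤m+n ∣ R ∩ V (A s) ∣ _ ⟩
      3 * ∣ R ∩ V (A s) ∣   ∎))
      where open ≤-Reasoning

    T4 : ∀ s → 𝒯 s → ¬ (S ⊆ V (A s))
    T4 s (o , small) S⊆A = none _ _ (separation⇒vertexSeparation G s , ≤-pred o , inj₂ (small , S⊆A))

  goodSeparation? : ∀ P Q → Dec (GoodSeparation P Q)
  goodSeparation? P Q = vertexSeparation? G P Q ×-dec ∣ P ∩ Q ∣ ≤? k ×-dec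
                        (((∣ R ∣ ≤? 3 * ∣ R ∩ P ∣) ×-dec (∣ R ∣ ≤? 3 * ∣ R ∩ Q ∣)) ⊎-dec
                         ((3 * ∣ R ∩ P ∣ <? ∣ R ∣) ×-dec (S ⊆? P)))

  good-separation : ¬ TangleOf G S (suc k) → ∃₂ GoodSeparation
  good-separation no-tangle with anySubset? (λ P → anySubset? (goodSeparation? P))
  ... | yes (P , Q , good) = P , Q , good
  ... | no  none           = ⊥-elim (no-tangle (tangle-of-small-sides λ P Q good → none (P , Q , good)))

module Decompositions {n : ℕ} (G : Graph n) (S : Subset n) (b : ℕ) where

  infix 4 ∂_⊆_
  ∂_⊆_ : Subset n → Subset n → Set
  ∂ Z ⊆ R = ∀ {z y} → z ∈ Z → y ∉ Z → adj G z y ≡ true → z ∈ R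

  -- The induction invariant: a tree decomposition as in TreeDecOf whose vertex set lies in Z
  -- and contains S ∩ Z, with R in the root bag.  The subtree condition is recorded as `top`.
  record Decomposition (Z R : Subset n) : Set where
    field
      vertices          : Subset n
      vertices⊆Z        : vertices ⊆ Z
      S∩Z⊆vertices      : S ∩ Z ⊆ vertices
      size              : ℕ
      rooted-tree       : RootedTree size
      bag               : Fin (suc size) → Subset n
      bag⊆vertices      : ∀ x → bag x ⊆ vertices
      R⊆root            : R ⊆ bag zero
      bag-size          : ∀ x → ∣ bag x ∣ ≤ b
      edge-in-bag       : ∀ u v → u ∈ vertices → v ∈ vertices → adj G u v ≡ true →
                          ∃ λ x → u ∈ bag x × v ∈ bag x
      top               : ∀ v → v ∈ vertices →
                          ∃ λ t → v ∈ bag t × HangsFrom rooted-tree t (λ x → v ∈ bag x)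
      component-in-bag  : ∀ C → IsComponentOutside G vertices C →
                          ∃ λ x → ∀ v → v ∉ C → (∃ λ c → c ∈ C × adj G c v ≡ true) → v ∈ bag x
  open Decomposition public

  shrink-root : ∀ {Z R R′} → R′ ⊆ R → Decomposition Z R → Decomposition Z R′
  shrink-root R′⊆R D = record
    { vertices = vertices D ; vertices⊆Z = vertices⊆Z D ; S∩Z⊆vertices = S∩Z⊆vertices D
    ; size = size D ; rooted-tree = rooted-tree D ; bag = bag D ; bag⊆vertices = bag⊆vertices D
    ; R⊆root = R⊆root D ∘ R′⊆R ; bag-size = bag-size D ; edge-in-bag = edge-in-bag D
    ; top = top D ; component-in-bag = component-in-bag D }

  leaf : ∀ {Z B} → B ⊆ Z → S ∩ Z ⊆ B → ∣ B ∣ ≤ b → Decomposition Z B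
  leaf {B = B} B⊆Z S∩Z⊆B ∣B∣≤b = record
    { vertices = B ; vertices⊆Z = B⊆Z ; S∩Z⊆vertices = S∩Z⊆B ; size = 0
    ; rooted-tree = record { parent = λ x → x ; parent-< = λ { zero 0≢0 → ⊥-elim (0≢0 refl) } }
    ; bag = λ _ → B ; bag⊆vertices = λ _ v∈B → v∈B ; R⊆root = λ v∈B → v∈B ; bag-size = λ _ → ∣B∣≤b
    ; edge-in-bag = λ _ _ u∈B v∈B _ → zero , u∈B , v∈B
    ; top = λ v v∈B → zero , v∈B , λ { zero _ 0≢0 → ⊥-elim (0≢0 refl) }
    ; component-in-bag = λ C (_ , _ , _ , closed) → zero , neighbour∈B C closed }
    where
    neighbour∈B : ∀ C → (∀ c d → c ∈ C → d ∉ B → adj G c d ≡ true → d ∈ C) →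
                  ∀ v → v ∉ C → (∃ λ c → c ∈ C × adj G c v ≡ true) → v ∈ B
    neighbour∈B C closed v v∉C (c , c∈C , e) with v ∈? B
    ... | yes v∈B = v∈B
    ... | no  v∉B = ⊥-elim (v∉C (closed c v c∈C v∉B e))

  root-hangs : ∀ {Z R} (D : Decomposition Z R) {v} → v ∈ bag D zero →
               HangsFrom (rooted-tree D) zero (λ x → v ∈ bag D x)
  root-hangs D {v} v∈root with top D v (bag⊆vertices D zero v∈root)
  ... | _ , _ , hangs = hangs-from-root (rooted-tree D) (λ x → v ∈ bag D x) hangs v∈root

  ∂-side : ∀ {Z R P Q} → ∂ Z ⊆ R → VertexSeparation G P Q → ∂ (Z ∩ P) ⊆ Z ∩ P ∩ (R ∪ Q)
  ∂-side {Z} {R} {P} {Q} ∂Z⊆R PQ {z} {y} z∈Z∩P y∉Z∩P e = x∈p∩q⁺ (z∈Z , x∈p∩q⁺ (z∈P , x∈p∪q⁺ z∈R⊎Q))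
    where
    z∈Z = proj₁ (x∈p∩q⁻ Z P z∈Z∩P)
    z∈P = proj₂ (x∈p∩q⁻ Z P z∈Z∩P)
    z∈R⊎Q : z ∈ R ⊎ z ∈ Q
    z∈R⊎Q with y ∈? Z | splits PQ z y e
    ... | no  y∉Z | _               = inj₁ (∂Z⊆R z∈Z y∉Z e)
    ... | yes y∈Z | inj₁ (_ , y∈P) = ⊥-elim (y∉Z∩P (x∈p∩q⁺ (y∈Z , y∈P)))
    ... | yes _   | inj₂ (z∈Q , _) = inj₂ z∈Q

  module Glue {Z R P Q : Subset n} (R⊆Z : R ⊆ Z) (∂Z⊆R : ∂ Z ⊆ R) (PQ : VertexSeparation G P Q)
              (DP : Decomposition (Z ∩ P) (Z ∩ P ∩ (R ∪ Q)))
              (DQ : Decomposition (Z ∩ Q) (Z ∩ Q ∩ (R ∪ P)))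
              (∣root∣≤b : ∣ R ∪ Z ∩ P ∩ Q ∣ ≤ b) where

    -- The sides are indexed by Bool so that every argument below is made once for both.
    side : Bool → Subset n
    side true  = P
    side false = Q

    D : (s : Bool) → Decomposition (Z ∩ side s) (Z ∩ side s ∩ (R ∪ side (not s)))
    D true  = DP
    D false = DQ

    X : Subset n
    X = Z ∩ P ∩ Q

    root-bag : Subset n
    root-bag = R ∪ X

    H : Subset n
    H = vertices DP ∪ vertices DQ

    in-X : ∀ {s s′ v} → s ≢ s′ → v ∈ Z → v ∈ side s → v ∈ side s′ → v ∈ X
    in-X {true}  {true}  s≢s′ _ _ _ = ⊥-elim (s≢s′ refl)
    in-X {false} {false} s≢s′ _ _ _ = ⊥-elim (s≢s′ refl)
    in-X {true}  {false} _ v∈Z v∈P v∈Q = x∈p∩q⁺ (v∈Z , x∈p∩q⁺ (v∈P , v∈Q))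
    in-X {false} {true}  _ v∈Z v∈Q v∈P = x∈p∩q⁺ (v∈Z , x∈p∩q⁺ (v∈P , v∈Q))

    X-elim : ∀ s {v} → v ∈ X → v ∈ Z × v ∈ side s × v ∈ side (not s)
    X-elim s {v} v∈X with x∈p∩q⁻ Z (P ∩ Q) v∈X
    ... | v∈Z , v∈P∩Q with x∈p∩q⁻ P Q v∈P∩Q
    ...   | v∈P , v∈Q = v∈Z , on-both s
      where
      on-both : ∀ s → v ∈ side s × v ∈ side (not s)
      on-both true  = v∈P , v∈Q
      on-both false = v∈Q , v∈P

    side-of : ∀ v → ∃ λ s → v ∈ side s
    side-of v with covers PQ v
    ... | inj₁ v∈P = true  , v∈P
    ... | inj₂ v∈Q = false , v∈Q

    edge-side : ∀ {u w} → adj G u w ≡ true → ∃ λ s → u ∈ side s × w ∈ side s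
    edge-side {u} {w} e with splits PQ u w e
    ... | inj₁ (u∈P , w∈P) = true  , u∈P , w∈P
    ... | inj₂ (u∈Q , w∈Q) = false , u∈Q , w∈Q

    stays : ∀ s {u w} → u ∈ Z → u ∈ side s → u ∉ X → adj G u w ≡ true → w ∈ side s
    stays s u∈Z u∈s u∉X e with edge-side e
    ... | s′ , u∈s′ , w∈s′ with s ≟ᵇ s′
    ...   | yes refl = w∈s′
    ...   | no  s≢s′ = ⊥-elim (u∉X (in-X s≢s′ u∈Z u∈s u∈s′))

    vertices-side : ∀ s {v} → v ∈ vertices (D s) → v ∈ Z × v ∈ side s
    vertices-side s v∈ = x∈p∩q⁻ Z (side s) (vertices⊆Z (D s) v∈)

    into-root : ∀ s {v} → v ∈ Z → v ∈ side s → v ∈ R ⊎ v ∈ side (not s) → v ∈ bag (D s) zero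
    into-root s v∈Z v∈s v∈R⊎ = R⊆root (D s) (x∈p∩q⁺ (v∈Z , x∈p∩q⁺ (v∈s , x∈p∪q⁺ v∈R⊎)))

    root-bag-side : ∀ s {v} → v ∈ root-bag → v ∈ R ⊎ v ∈ side (not s)
    root-bag-side s {v} v∈root with x∈p∪q⁻ R X v∈root
    ... | inj₁ v∈R = inj₁ v∈R
    ... | inj₂ v∈X = inj₂ (proj₂ (proj₂ (X-elim s v∈X)))

    H-intro : ∀ s {v} → v ∈ vertices (D s) → v ∈ H
    H-intro true  v∈ = x∈p∪q⁺ (inj₁ v∈)
    H-intro false v∈ = x∈p∪q⁺ (inj₂ v∈)

    H-elim : ∀ {v} → v ∈ H → ∃ λ s → v ∈ vertices (D s)
    H-elim v∈H with x∈p∪q⁻ (vertices DP) (vertices DQ) v∈H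
    ... | inj₁ v∈ = true  , v∈
    ... | inj₂ v∈ = false , v∈

    X⊆vertices : ∀ s {v} → v ∈ X → v ∈ vertices (D s)
    X⊆vertices s v∈X =
      let v∈Z , v∈s , v∈s′ = X-elim s v∈X
      in bag⊆vertices (D s) zero (into-root s v∈Z v∈s (inj₂ v∈s′))

    R⊆H : R ⊆ H
    R⊆H {v} v∈R =
      let s , v∈s = side-of v
      in H-intro s (bag⊆vertices (D s) zero (into-root s (R⊆Z v∈R) v∈s (inj₁ v∈R)))

    X⊆H : X ⊆ H
    X⊆H v∈X = H-intro true (X⊆vertices true v∈X)

    H∩side⊆vertices : ∀ s {v} → v ∈ H → v ∈ side s → v ∈ vertices (D s)
    H∩side⊆vertices s v∈H v∈s with H-elim v∈H
    ... | s′ , v∈D with s ≟ᵇ s′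
    ...   | yes refl = v∈D
    ...   | no  s≢s′ = let v∈Z , v∈s′ = vertices-side s′ v∈D in X⊆vertices s (in-X s≢s′ v∈Z v∈s v∈s′)

    open Join (λ s → size (D s)) (λ s → rooted-tree (D s))

    bagᴶ : Fin (suc (left + right)) → Subset n
    bagᴶ = branch root-bag (λ s → bag (D s))

    to-ι : ∀ s i {v} → v ∈ bag (D s) i → v ∈ bagᴶ (ι s i)
    to-ι s i {v} = subst (v ∈_) (sym (branch-ι root-bag (λ s → bag (D s)) s i))

    from-ι : ∀ s i {v} → v ∈ bagᴶ (ι s i) → v ∈ bag (D s) i
    from-ι s i {v} = subst (v ∈_) (branch-ι root-bag (λ s → bag (D s)) s i)

    bagᴶ⊆H : ∀ {x} → View x → bagᴶ x ⊆ H
    bagᴶ⊆H root v∈root with x∈p∪q⁻ R X v∈root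
    ... | inj₁ v∈R = R⊆H v∈R
    ... | inj₂ v∈X = X⊆H v∈X
    bagᴶ⊆H (child s i) v∈ = H-intro s (bag⊆vertices (D s) i (from-ι s i v∈))

    bagᴶ-size : ∀ {x} → View x → ∣ bagᴶ x ∣ ≤ b
    bagᴶ-size root        = ∣root∣≤b
    bagᴶ-size (child s i) = subst (λ B → ∣ B ∣ ≤ b) (sym (branch-ι root-bag (λ s → bag (D s)) s i)) (bag-size (D s) i)

    S∩Z⊆H : S ∩ Z ⊆ H
    S∩Z⊆H {v} v∈S∩Z =
      let v∈S , v∈Z = x∈p∩q⁻ S Z v∈S∩Z
          s , v∈s   = side-of v
      in H-intro s (S∩Z⊆vertices (D s) (x∈p∩q⁺ (v∈S , x∈p∩q⁺ (v∈Z , v∈s))))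

    edge-in-bagᴶ : ∀ u v → u ∈ H → v ∈ H → adj G u v ≡ true → ∃ λ x → u ∈ bagᴶ x × v ∈ bagᴶ x
    edge-in-bagᴶ u v u∈H v∈H e =
      let s , u∈s , v∈s  = edge-side e
          x , u∈x , v∈x = edge-in-bag (D s) u v (H∩side⊆vertices s u∈H u∈s) (H∩side⊆vertices s v∈H v∈s) e
      in ι s x , to-ι s x u∈x , to-ι s x v∈x

    climbs-to-root : ∀ {v x} → v ∈ root-bag → View x → v ∈ bagᴶ x → x ≢ zero → v ∈ bagᴶ (parent joined x)
    climbs-to-root v∈root root _ 0≢0 = ⊥-elim (0≢0 refl)
    climbs-to-root {v} v∈root (child s zero) _ _ =
      subst (λ y → v ∈ bagᴶ y) (sym (parent-ι-zero s)) v∈root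
    climbs-to-root {v} v∈root (child s (suc i)) v∈x _ =
      subst (λ y → v ∈ bagᴶ y) (sym (parent-ι s (suc i) (λ ())))
            (to-ι s _ (proj₂ (root-hangs (D s) v∈D-root (suc i) v∈i (λ ()))))
      where
      v∈i = from-ι s (suc i) v∈x
      v∈D-root : v ∈ bag (D s) zero
      v∈D-root = let v∈Z , v∈s = vertices-side s (bag⊆vertices (D s) (suc i) v∈i)
                 in into-root s v∈Z v∈s (root-bag-side s v∈root)

    ι≢zero : ∀ s i → ι s i ≢ zero
    ι≢zero true  _ ()
    ι≢zero false _ ()

    climbs-within-side : ∀ {v s t} → v ∉ root-bag → v ∈ vertices (D s) →
                         HangsFrom (rooted-tree (D s)) t (λ i → v ∈ bag (D s) i) →
                         ∀ {x} → View x → v ∈ bagᴶ x → x ≢ ι s t → x ≢ zero × v ∈ bagᴶ (parent joined x)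
    climbs-within-side v∉root _ _ root v∈x _ = ⊥-elim (v∉root v∈x)
    climbs-within-side {v} {s} {t} v∉root v∈D hangs (child s′ i) v∈x x≢ιt with s′ ≟ᵇ s
    ... | no s′≢s =
      let v∈Z , v∈s′ = vertices-side s′ (bag⊆vertices (D s′) i (from-ι s′ i v∈x))
      in ⊥-elim (v∉root (x∈p∪q⁺ (inj₂ (in-X s′≢s v∈Z v∈s′ (proj₂ (vertices-side s v∈D))))))
    ... | yes refl =
      let i≢0 , v∈parent = hangs i (from-ι s i v∈x) (λ i≡t → x≢ιt (cong (ι s) i≡t))
      in ι≢zero s i , subst (λ y → v ∈ bagᴶ y) (sym (parent-ι s i i≢0)) (to-ι s _ v∈parent)

    topᴶ : ∀ v → v ∈ H → ∃ λ t → v ∈ bagᴶ t × HangsFrom joined t (λ x → v ∈ bagᴶ x)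
    topᴶ v v∈H with v ∈? root-bag
    ... | yes v∈root = zero , v∈root , λ x v∈x x≢0 → x≢0 , climbs-to-root v∈root (view x) v∈x x≢0
    ... | no  v∉root =
      let s , v∈D         = H-elim v∈H
          t , v∈t , hangs = top (D s) v v∈D
      in ι s t , to-ι s t v∈t , λ x → climbs-within-side v∉root v∈D hangs (view x)

    -- A component of G - H crosses neither ∂Z ⊆ R ⊆ H nor X ⊆ H, so it lies outside Z or
    -- inside Z on a single side.
    module _ {C : Subset n} (C∩H≡∅ : ∀ v → v ∈ C → v ∉ H) where

      Z-closed : ∀ {u w} → u ∈ C → u ∈ Z → adj G u w ≡ true → w ∈ Z
      Z-closed {u} {w} u∈C u∈Z e with w ∈? Z
      ... | yes w∈Z = w∈Z
      ... | no  w∉Z = ⊥-elim (C∩H≡∅ u u∈C (R⊆H (∂Z⊆R u∈Z w∉Z e)))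

      coZ-closed : ∀ {u w} → w ∈ C → adj G u w ≡ true → u ∉ Z → w ∉ Z
      coZ-closed w∈C e u∉Z w∈Z = C∩H≡∅ _ w∈C (R⊆H (∂Z⊆R w∈Z u∉Z (adj-sym G _ _ e)))

      side-closed : ∀ s {u w} → u ∈ C → u ∈ Z → u ∈ side s → adj G u w ≡ true → w ∈ side s
      side-closed s u∈C u∈Z u∈s = stays s u∈Z u∈s (λ u∈X → C∩H≡∅ _ u∈C (X⊆H u∈X))

    component-in-bagᴶ : ∀ C → IsComponentOutside G H C →
                        ∃ λ x → ∀ v → v ∉ C → (∃ λ c → c ∈ C × adj G c v ≡ true) → v ∈ bagᴶ x
    component-in-bagᴶ C ((c₀ , c₀∈C) , C∩H≡∅ , C-connected , C-closed) with c₀ ∈? Z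
    ... | no c₀∉Z = zero , neighbour∈root
      where
      neighbour∈root : ∀ v → v ∉ C → (∃ λ c → c ∈ C × adj G c v ≡ true) → v ∈ root-bag
      neighbour∈root v v∉C (c , c∈C , e) with v ∈? H
      ... | no  v∉H = ⊥-elim (v∉C (C-closed c v c∈C v∉H e))
      ... | yes v∈H = x∈p∪q⁺ (inj₁ (∂Z⊆R v∈Z c∉Z (adj-sym G c v e)))
        where
        v∈Z = proj₁ (vertices-side _ (proj₂ (H-elim v∈H)))
        c∉Z = walk-preserves (_∉ Z) (λ _ w∈C → coZ-closed C∩H≡∅ w∈C) (C-connected c₀ c c₀∈C c∈C) c₀∉Z
    ... | yes c₀∈Z =
      let s , c₀∈s = side-of c₀
          x , nb   = component-in-bag (D s) C ((c₀ , c₀∈C) , (λ v v∈C v∈D → C∩H≡∅ v v∈C (H-intro s v∈D)) ,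
                                                C-connected , closed s c₀∈s)
      in ι s x , λ v v∉C adjacent → to-ι s x (nb v v∉C adjacent)
      where
      closed : ∀ s → c₀ ∈ side s → ∀ c d → c ∈ C → d ∉ vertices (D s) → adj G c d ≡ true → d ∈ C
      closed s c₀∈s c d c∈C d∉D e = C-closed c d c∈C (λ d∈H → d∉D (H∩side⊆vertices s d∈H d∈s)) e
        where
        stays-in-side : ∀ {u w} → u ∈ C → w ∈ C → adj G u w ≡ true → u ∈ Z × u ∈ side s → w ∈ Z × w ∈ side s
        stays-in-side u∈C _ e (u∈Z , u∈s) = Z-closed C∩H≡∅ u∈C u∈Z e , side-closed C∩H≡∅ s u∈C u∈Z u∈s e
        c∈Z×s = walk-preserves (λ u → u ∈ Z × u ∈ side s) stays-in-side (C-connected c₀ c c₀∈C c∈C) (c₀∈Z , c₀∈s)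
        d∈s = side-closed C∩H≡∅ s c∈C (proj₁ c∈Z×s) (proj₂ c∈Z×s) e

    glued : Decomposition Z R
    glued = record
      { vertices = H
      ; vertices⊆Z = λ v∈H → proj₁ (vertices-side _ (proj₂ (H-elim v∈H)))
      ; S∩Z⊆vertices = S∩Z⊆H
      ; size = left + right ; rooted-tree = joined ; bag = bagᴶ
      ; bag⊆vertices = λ x → bagᴶ⊆H (view x)
      ; R⊆root = λ v∈R → x∈p∪q⁺ (inj₁ v∈R)
      ; bag-size = λ x → bagᴶ-size (view x)
      ; edge-in-bag = edge-in-bagᴶ
      ; top = topᴶ
      ; component-in-bag = component-in-bagᴶ
      }

  toTreeDecOf : ∀ {R} → Decomposition ⊤ R → TreeDecOf G S
  toTreeDecOf D = record
    { U = vertices D ; S⊆U = λ v∈S → S∩Z⊆vertices D (x∈p∩q⁺ (v∈S , ∈⊤))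
    ; m = size D ; T = treeGraph (rooted-tree D) ; tree = treeGraph-isTree (rooted-tree D)
    ; W = bag D ; W⊆U = bag⊆vertices D ; edgeBag = edge-in-bag D
    ; vNonEmp = λ v v∈ → let t , v∈t , _ = top D v v∈ in t , v∈t
    ; vConn = λ v v∈ → let _ , _ , hangs = top D v v∈ in hangs⇒connected (rooted-tree D) hangs
    ; compBag = component-in-bag D
    }

small-part-fits : ∀ {w ρ a} → 6 * w ≤ ρ → 3 * a < ρ → a + w ≤ ρ
small-part-fits {w} {ρ} {a} 6w≤ρ 3a<ρ = *-cancelˡ-≤ 3 (begin
  3 * (a + w)     ≡⟨ *-distribˡ-+ 3 a w ⟩
  3 * a + 3 * w   ≤⟨ +-mono-≤ (<⇒≤ 3a<ρ) (≤-trans (*-monoˡ-≤ w (m≤m+n 3 3)) 6w≤ρ) ⟩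
  ρ + ρ           ≤⟨ m≤m+n (ρ + ρ) ρ ⟩
  ρ + ρ + ρ       ≡⟨ solve (ρ ∷ []) ⟩
  3 * ρ           ∎)
  where open ≤-Reasoning

balanced-part-fits : ∀ {w ρ a c x} → 6 * w ≤ ρ → x ≤ w → a + c ≤ ρ + x → ρ ≤ 3 * c → a + w ≤ ρ
balanced-part-fits {w} {ρ} {a} {c} {x} 6w≤ρ x≤w a+c≤ρ+x ρ≤3c = *-cancelˡ-≤ 3 (+-cancelʳ-≤ ρ _ _ (begin
  3 * (a + w) + ρ       ≤⟨ +-monoʳ-≤ (3 * (a + w)) ρ≤3c ⟩
  3 * (a + w) + 3 * c   ≡⟨ solve (a ∷ w ∷ c ∷ []) ⟩
  3 * (a + c) + 3 * w   ≤⟨ +-monoˡ-≤ (3 * w) (*-monoʳ-≤ 3 (≤-trans a+c≤ρ+x (+-monoʳ-≤ ρ x≤w))) ⟩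
  3 * (ρ + w) + 3 * w   ≡⟨ solve (ρ ∷ w ∷ []) ⟩
  3 * ρ + 6 * w         ≤⟨ +-monoʳ-≤ (3 * ρ) 6w≤ρ ⟩
  3 * ρ + ρ             ∎))
  where open ≤-Reasoning

module Construction {n : ℕ} (G : Graph n) (S : Subset n) (w ρ : ℕ) (1≤w : 1 ≤ w) (6w≤ρ : 6 * w ≤ ρ)
                    (no-tangle : ¬ TangleOf G S (suc w)) where

  open Decompositions G S (ρ + w)

  module Split {Z R : Subset n} (R⊆Z : R ⊆ Z) (∂Z⊆R : ∂ Z ⊆ R) (∣R∣≡ρ : ∣ R ∣ ≡ ρ)
               (recurse : ∀ {Z′ R′} → Z′ ⊂ Z → R′ ⊆ Z′ → ∂ Z′ ⊆ R′ → ∣ R′ ∣ ≤ ρ → Decomposition Z′ R′) where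

    side : ∀ {P Q} → VertexSeparation G P Q → ∣ P ∩ Q ∣ ≤ w → ∣ R ∩ P ∣ + w ≤ ρ →
           Decomposition (Z ∩ P) (Z ∩ P ∩ (R ∪ Q))
    side {P} {Q} PQ ∣P∩Q∣≤w fits =
      recurse (z∩p⊂z R⊆Z ∣R∩P∣<∣R∣) (z∩p∩[r∪q]⊆z∩p Z P R Q) (∂-side ∂Z⊆R PQ)
              (≤-trans (∣z∩p∩[r∪q]∣≤∣r∩p∣+∣p∩q∣ Z P R Q) (≤-trans (+-monoʳ-≤ ∣ R ∩ P ∣ ∣P∩Q∣≤w) fits))
      where
      ∣R∩P∣<∣R∣ : ∣ R ∩ P ∣ < ∣ R ∣
      ∣R∩P∣<∣R∣ = subst (∣ R ∩ P ∣ <_) (sym ∣R∣≡ρ) (<-≤-trans (m<m+n ∣ R ∩ P ∣ 1≤w) fits)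

    balanced-fits : ∀ {P Q} → ∣ P ∩ Q ∣ ≤ w → ∣ R ∣ ≤ 3 * ∣ R ∩ Q ∣ → ∣ R ∩ P ∣ + w ≤ ρ
    balanced-fits {P} {Q} ∣P∩Q∣≤w Q-large =
      balanced-part-fits {a = ∣ R ∩ P ∣} {∣ R ∩ Q ∣} 6w≤ρ ∣P∩Q∣≤w
        (subst (λ r → ∣ R ∩ P ∣ + ∣ R ∩ Q ∣ ≤ r + ∣ P ∩ Q ∣) ∣R∣≡ρ (∣r∩p∣+∣r∩q∣≤∣r∣+∣p∩q∣ R P Q))
        (subst (_≤ 3 * ∣ R ∩ Q ∣) ∣R∣≡ρ Q-large)

    split : Decomposition Z R
    split with good-separation G S w R no-tangle
    ... | P , Q , PQ , ∣P∩Q∣≤w , kind = Glue.glued R⊆Z ∂Z⊆R PQ (P-side kind) (Q-side kind) ∣root∣≤ρ+w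
      where
      ∣Q∩P∣≤w : ∣ Q ∩ P ∣ ≤ w
      ∣Q∩P∣≤w = subst (_≤ w) (cong ∣_∣ (∩-comm P Q)) ∣P∩Q∣≤w

      P-side : Balanced R P Q ⊎ Small R P × S ⊆ P → Decomposition (Z ∩ P) (Z ∩ P ∩ (R ∪ Q))
      P-side (inj₁ (_ , Q-large)) = side PQ ∣P∩Q∣≤w (balanced-fits ∣P∩Q∣≤w Q-large)
      P-side (inj₂ (P-small , _)) =
        side PQ ∣P∩Q∣≤w (small-part-fits {a = ∣ R ∩ P ∣} 6w≤ρ (subst (3 * ∣ R ∩ P ∣ <_) ∣R∣≡ρ P-small))

      Q-side : Balanced R P Q ⊎ Small R P × S ⊆ P → Decomposition (Z ∩ Q) (Z ∩ Q ∩ (R ∪ P))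
      Q-side (inj₁ (P-large , _)) = side (swapᵛ G PQ) ∣Q∩P∣≤w (balanced-fits ∣Q∩P∣≤w P-large)
      Q-side (inj₂ (_ , S⊆P))     = leaf (z∩p∩[r∪q]⊆z∩p Z Q R P) S∩Z∩Q⊆ (≤-trans
        (∣z∩p∩[r∪q]∣≤∣r∩p∣+∣p∩q∣ Z Q R P)
        (+-mono-≤ (≤-trans (∣p∩q∣≤∣p∣ R Q) (≤-reflexive ∣R∣≡ρ)) ∣Q∩P∣≤w))
        where
        S∩Z∩Q⊆ : S ∩ (Z ∩ Q) ⊆ Z ∩ Q ∩ (R ∪ P)
        S∩Z∩Q⊆ v∈ =
          let v∈S , v∈Z∩Q = x∈p∩q⁻ S _ v∈
              v∈Z , v∈Q   = x∈p∩q⁻ Z Q v∈Z∩Q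
          in x∈p∩q⁺ (v∈Z , x∈p∩q⁺ (v∈Q , x∈p∪q⁺ (inj₂ (S⊆P v∈S))))

      ∣root∣≤ρ+w : ∣ R ∪ Z ∩ P ∩ Q ∣ ≤ ρ + w
      ∣root∣≤ρ+w = ≤-trans (∣p∪q∣≤∣p∣+∣q∣ R (Z ∩ P ∩ Q))
        (+-mono-≤ (≤-reflexive ∣R∣≡ρ) (≤-trans (∣p∩q∣≤∣q∣ Z (P ∩ Q)) ∣P∩Q∣≤w))

  decompose : ∀ Z {R} → R ⊆ Z → ∂ Z ⊆ R → ∣ R ∣ ≤ ρ → Decomposition Z R
  decompose Z = go (⊂-wellFounded Z)
    where
    go : ∀ {Z R} → Acc _⊂_ Z → R ⊆ Z → ∂ Z ⊆ R → ∣ R ∣ ≤ ρ → Decomposition Z R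
    go {Z} {R} (acc rec) R⊆Z ∂Z⊆R ∣R∣≤ρ with extend-within ρ (p⊆p∪q {p = R} (S ∩ Z)) ∣R∣≤ρ
    ... | R′ , R⊆R′ , R′⊆R∪S∩Z , ∣R′∣≤ρ , full = shrink-root R⊆R′ (decompose′ full)
      where
      R′⊆Z : R′ ⊆ Z
      R′⊆Z v∈R′ with x∈p∪q⁻ R (S ∩ Z) (R′⊆R∪S∩Z v∈R′)
      ... | inj₁ v∈R   = R⊆Z v∈R
      ... | inj₂ v∈S∩Z = p∩q⊆q S Z v∈S∩Z
      decompose′ : ∣ R′ ∣ ≡ ρ ⊎ R ∪ S ∩ Z ⊆ R′ → Decomposition Z R′
      decompose′ (inj₁ ∣R′∣≡ρ) =
        Split.split R′⊆Z (λ z∈Z y∉Z e → R⊆R′ (∂Z⊆R z∈Z y∉Z e)) ∣R′∣≡ρ (λ Z′⊂Z → go (rec Z′⊂Z))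
      decompose′ (inj₂ R∪S∩Z⊆R′) =
        leaf R′⊆Z (R∪S∩Z⊆R′ ∘ q⊆p∪q R (S ∩ Z)) (≤-trans ∣R′∣≤ρ (m≤m+n ρ w))

  no-tangle⇒decomposition : ∀ R → ∣ R ∣ ≤ ρ →
    Σ (TreeDecOf G S) λ D → (∀ x → ∣ W D x ∣ ≤ ρ + w) × ∃ λ x → R ⊆ W D x
  no-tangle⇒decomposition R ∣R∣≤ρ =
    let D = decompose ⊤ (λ _ → ∈⊤) (λ _ y∉⊤ _ → ⊥-elim (y∉⊤ ∈⊤)) ∣R∣≤ρ
    in toTreeDecOf D , bag-size D , zero , R⊆root D

lemma6p1 : (k : ℕ) → 2 ≤ k → (n : ℕ) (G : Graph n) (S : Subset n) →
    ¬ TangleOf G S k →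
    (R : Subset n) → ∣ R ∣ ≤ 7 * k ∸ 8 →
    Σ (TreeDecOf G S) λ D → WidthAtMost D (10 * k ∸ 12) × ∃ λ x → R ⊆ W D x
lemma6p1 (suc (suc j)) (s≤s (s≤s z≤n)) n G S no-tangle R ∣R∣≤ρ =
  let D , bag-bound , x , R⊆x = no-tangle⇒decomposition G S (suc j) (6 + 7 * j) (s≤s z≤n) 6w≤ρ no-tangle R
                                  (subst (∣ R ∣ ≤_) 7k∸8≡ρ ∣R∣≤ρ)
  in D , (λ y → width-bound (bag-bound y)) , x , R⊆x
  where
  open Construction using (no-tangle⇒decomposition)
  open ≤-Reasoning

  7k≡8+ρ : 7 * suc (suc j) ≡ 8 + (6 + 7 * j)
  7k≡8+ρ = solve (j ∷ [])

  10k≡12+[8+10j] : 10 * suc (suc j) ≡ 12 + (8 + 10 * j)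
  10k≡12+[8+10j] = solve (j ∷ [])

  7k∸8≡ρ : 7 * suc (suc j) ∸ 8 ≡ 6 + 7 * j
  7k∸8≡ρ = cong (_∸ 8) 7k≡8+ρ

  6w≤ρ : 6 * suc j ≤ 6 + 7 * j
  6w≤ρ = subst (_≤ 6 + 7 * j) (sym (*-suc 6 j)) (+-monoʳ-≤ 6 (*-monoˡ-≤ j (n≤1+n 6)))

  ρ+w≤9+10j : (6 + 7 * j) + suc j ≤ 9 + 10 * j
  ρ+w≤9+10j = begin
    (6 + 7 * j) + suc j                ≤⟨ m≤m+n _ (2 + 2 * j) ⟩
    (6 + 7 * j) + suc j + (2 + 2 * j)  ≡⟨ solve (j ∷ []) ⟩
    9 + 10 * j                         ∎

  width-bound : ∀ {s} → s ≤ (6 + 7 * j) + suc j → s ∸ 1 ≤ 10 * suc (suc j) ∸ 12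
  width-bound {s} s≤ = subst (s ∸ 1 ≤_) (sym (cong (_∸ 12) 10k≡12+[8+10j])) (∸-monoˡ-≤ 1 (≤-trans s≤ ρ+w≤9+10j))
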